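{- Fix $m \geq 6$. Let $A$ be the $m \times (m+1)$ matrix with entries in $\{0,1\}$ defined as follows: for $1 \leq i \leq m-1$ and $1 \leq j \leq m+1$, $A_{i,j} = 1$ if and only if $i \leq j \leq i+2$; and for $1 \leq j \leq m+1$, $A_{m,j} = 1$ if and only if $j \in \{1,2,4,7\}$. Let $c = (3,3,\ldots,3,4)^T$ be the column vector of length $m$ consisting of $m-1$ entries equal to $3$ followed by a single $4$. Then the unique solution of the system $A x = c$ with $x \in \mathbb{N}^{m+1}$ is $x = (1,1,\ldots,1)^T$.
   Context: $\mathbb{N}$ denotes the natural numbers including $0$. -}

module Defs where

open import Data.Nat using (ℕ; zero; suc; _+_; _*_; _≤_; _≤ᵇ_; _≡ᵇ_)
open import Data.Bool using (Bool; true; false; if_then_else_; _∧_; _∨_)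
open import Data.Fin using (Fin; toℕ) renaming (zero to fzero; suc to fsuc)

∑ : ∀ {n} → (Fin n → ℕ) → ℕ
∑ {zero} f = 0
∑ {suc n} f = f fzero + ∑ (λ i → f (fsuc i))

-- 1-based row index i = toℕ r + 1, column index j = toℕ s + 1.
-- Row i (1 ≤ i ≤ m-1): A i j = 1 iff i ≤ j ≤ i+2.
-- Row m: A m j = 1 iff j ∈ {1,2,4,7}.
rowEntry : ℕ → ℕ → ℕ → Bool
rowEntry m i j =
  if i ≡ᵇ m
  then ((j ≡ᵇ 1) ∨ (j ≡ᵇ 2)) ∨ ((j ≡ᵇ 4) ∨ (j ≡ᵇ 7))
  else ((i ≤ᵇ j) ∧ (j ≤ᵇ i + 2))

A : (m : ℕ) → Fin m → Fin (suc m) → ℕ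
A m r s = if rowEntry m (suc (toℕ r)) (suc (toℕ s)) then 1 else 0

c : (m : ℕ) → Fin m → ℕ
c m r = if suc (toℕ r) ≡ᵇ m then 4 else 3

mulVec : ∀ {m n} → (Fin m → Fin n → ℕ) → (Fin n → ℕ) → Fin m → ℕ
mulVec M x r = ∑ (λ s → M r s * x s)

{-# OPTIONS --safe #-}
-- Rows 1, …, m-1 say that any three consecutive entries of x sum to 3, so x is
-- 3-periodic.  The last row then reads 3 x₁ + x₂ = 4 (this needs x₇, i.e. m ≥ 6),
-- which together with x₁ + x₂ + x₃ = 3 forces x₁ = x₂ = x₃ = 1, and periodicity
-- spreads this to all of x.
module Submission where

open import Defs
open import Data.Bool using (Bool; true; false; T; if_then_else_; _∧_; _∨_)
open import Data.Bool.Properties using (if-float; if-cong-then)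
open import Data.Fin using (Fin; toℕ; fromℕ<)
open import Data.Fin.Properties using (toℕ<n; toℕ-fromℕ<; toℕ-injective)
open import Data.Nat using (ℕ; zero; suc; _+_; _*_; _≤_; _<_; _≤ᵇ_; _≡ᵇ_; s≤s; s≤s⁻¹; _≟_)
open import Data.Nat.DivMod using (_mod_; m<n⇒m%n≡m)
open import Data.Nat.Properties
open import Data.Product using (_×_; _,_)
open import Relation.Binary.PropositionalEquality
  using (_≡_; _≢_; _≗_; refl; sym; trans; cong; cong₂; subst; module ≡-Reasoning)
open import Relation.Nullary using (¬_; yes; no; contradiction)

if-T : ∀ {A : Set} {b} {t e : A} → T b → (if b then t else e) ≡ t
if-T {b = true} _ = refl

if-¬T : ∀ {A : Set} {b} {t e : A} → ¬ T b → (if b then t else e) ≡ e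
if-¬T {b = false} _ = refl
if-¬T {b = true} ¬tt = contradiction _ ¬tt

if-≡ᵇ-≡ : ∀ {A : Set} {m n} {t e : A} → m ≡ n → (if m ≡ᵇ n then t else e) ≡ t
if-≡ᵇ-≡ {m = m} {n} m≡n = if-T (≡⇒≡ᵇ m n m≡n)

if-≡ᵇ-≢ : ∀ {A : Set} {m n} {t e : A} → m ≢ n → (if m ≡ᵇ n then t else e) ≡ e
if-≡ᵇ-≢ {m = m} {n} m≢n = if-¬T (λ m≡ᵇn → m≢n (≡ᵇ⇒≡ m n m≡ᵇn))

indicator-* : ∀ b n → (if b then 1 else 0) * n ≡ (if b then n else 0)
indicator-* b n = trans (if-float (_* n) b) (if-cong-then b (*-identityˡ n))

∑-cong : ∀ {n} {f g : Fin n → ℕ} → f ≗ g → ∑ f ≡ ∑ g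
∑-cong {zero} f≗g = refl
∑-cong {suc n} f≗g = cong₂ _+_ (f≗g _) (∑-cong (λ s → f≗g (Data.Fin.suc s)))

∑-zero : ∀ n → ∑ {n} (λ _ → 0) ≡ 0
∑-zero zero = refl
∑-zero (suc n) = ∑-zero n

-- The selector p sees 1-based indices, like the columns of A; y is 0-based.
sumWhere : ∀ n → (ℕ → Bool) → (ℕ → ℕ) → ℕ
sumWhere n p y = ∑ {n} (λ s → if p (suc (toℕ s)) then y (toℕ s) else 0)

sumWhere-cong : ∀ n {p q : ℕ → Bool} (y : ℕ → ℕ) → p ≗ q → sumWhere n p y ≡ sumWhere n q y
sumWhere-cong n y p≗q = ∑-cong {n} (λ s → cong (λ b → if b then y (toℕ s) else 0) (p≗q (suc (toℕ s))))

window : (ℕ → ℕ) → ℕ → ℕ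
window y k = y k + (y (1 + k) + y (2 + k))

inWindow : ℕ → ℕ → Bool
inWindow i j = (i ≤ᵇ j) ∧ (j ≤ᵇ i + 2)

inLastRow : ℕ → Bool
inLastRow j = ((j ≡ᵇ 1) ∨ (j ≡ᵇ 2)) ∨ ((j ≡ᵇ 4) ∨ (j ≡ᵇ 7))

-- inWindow (2 + k) (2 + j) reduces to inWindow (1 + k) (1 + j), so shifting y shifts the window.
sumWhere-inWindow : ∀ {k n} (y : ℕ → ℕ) → 2 + k ≤ n → sumWhere (suc n) (inWindow (suc k)) y ≡ window y k
sumWhere-inWindow {zero} {suc (suc n)} y (s≤s (s≤s _)) =
  cong (λ t → y 0 + (y 1 + t)) (trans (cong (y 2 +_) (∑-zero n)) (+-identityʳ (y 2)))
sumWhere-inWindow {suc k} y (s≤s 2+k≤n) = sumWhere-inWindow (λ j → y (suc j)) 2+k≤n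

sumWhere-inLastRow : ∀ n (y : ℕ → ℕ) → sumWhere (7 + n) inLastRow y ≡ y 0 + (y 1 + (y 3 + y 6))
sumWhere-inLastRow n y =
  cong (λ t → y 0 + (y 1 + (y 3 + t))) (trans (cong (y 6 +_) (∑-zero n)) (+-identityʳ (y 6)))

rowEntry-window : ∀ {m i} → i ≢ m → rowEntry m i ≗ inWindow i
rowEntry-window {i = i} i≢m j = if-≡ᵇ-≢ {m = i} i≢m

rowEntry-last : ∀ m → rowEntry m m ≗ inLastRow
rowEntry-last m j = if-≡ᵇ-≡ {m = m} refl

rowSum : ℕ → ℕ → (ℕ → ℕ) → ℕ
rowSum m i = sumWhere (suc m) (rowEntry m i)

rowSum-window : ∀ {m k} (y : ℕ → ℕ) → 2 + k ≤ m → rowSum m (suc k) y ≡ window y k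
rowSum-window {m} y 2+k≤m =
  trans (sumWhere-cong (suc m) y (rowEntry-window (<⇒≢ 2+k≤m))) (sumWhere-inWindow y 2+k≤m)

rowSum-last : ∀ n (y : ℕ → ℕ) → rowSum (6 + n) (6 + n) y ≡ y 0 + (y 1 + (y 3 + y 6))
rowSum-last n y = trans (sumWhere-cong (7 + n) y (rowEntry-last (6 + n))) (sumWhere-inLastRow n y)

-- Only the indices j ≤ m matter; reducing mod m+1 just makes the sequence total.
asSequence : ∀ {m} → (Fin (suc m) → ℕ) → ℕ → ℕ
asSequence {m} x j = x (j mod suc m)

mod-toℕ : ∀ {m} (s : Fin (suc m)) → toℕ s mod suc m ≡ s
mod-toℕ s = toℕ-injective (trans (toℕ-fromℕ< _) (m<n⇒m%n≡m (toℕ<n s)))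

mulVec-A≡rowSum : ∀ {m} (x : Fin (suc m) → ℕ) r → mulVec (A m) x r ≡ rowSum m (suc (toℕ r)) (asSequence x)
mulVec-A≡rowSum {m} x r = ∑-cong {suc m} λ s → let b = rowEntry m (suc (toℕ r)) (suc (toℕ s)) in
  trans (indicator-* b (x s)) (if-cong-then b (cong x (sym (mod-toℕ s))))

window-constant⇒periodic : ∀ {m t} (y : ℕ → ℕ) → (∀ k → 2 + k ≤ m → window y k ≡ t) →
  ∀ k → 3 + k ≤ m → y (3 + k) ≡ y k
window-constant⇒periodic y window≡t k 3+k≤m = +-cancelˡ-≡ (y (1 + k) + y (2 + k)) _ _ (begin
  y (1 + k) + y (2 + k) + y (3 + k) ≡⟨ +-assoc (y (1 + k)) _ _ ⟩
  window y (1 + k)                  ≡⟨ window≡t (1 + k) 3+k≤m ⟩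
  _                                 ≡⟨ window≡t k (≤-trans (n≤1+n _) 3+k≤m) ⟨
  window y k                        ≡⟨ +-comm (y k) _ ⟩
  y (1 + k) + y (2 + k) + y k       ∎)
  where open ≡-Reasoning

periodic-constant : ∀ {m a} (y : ℕ → ℕ) → (∀ k → 3 + k ≤ m → y (3 + k) ≡ y k) →
  y 0 ≡ a → y 1 ≡ a → y 2 ≡ a → ∀ j → j ≤ m → y j ≡ a
periodic-constant _ _ y₀ _ _ 0 _ = y₀
periodic-constant _ _ _ y₁ _ 1 _ = y₁
periodic-constant _ _ _ _ y₂ 2 _ = y₂
periodic-constant y period y₀ y₁ y₂ (suc (suc (suc j))) 3+j≤m =
  trans (period j 3+j≤m) (periodic-constant y period y₀ y₁ y₂ j (≤-trans (m≤n+m j 3) 3+j≤m))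

reduced-system-solution : ∀ a b c → a + (b + c) ≡ 3 → a + (a + (a + b)) ≡ 4 → a ≡ 1 × b ≡ 1 × c ≡ 1
reduced-system-solution 0 .4 _ () refl
reduced-system-solution 1 .1 .1 refl refl = refl , refl , refl
reduced-system-solution 2 _ _ _ ()
reduced-system-solution 3 _ _ _ ()
reduced-system-solution (suc (suc (suc (suc _)))) _ _ () _

row-equations⇒ones : ∀ n (y : ℕ → ℕ) → (∀ k → 2 + k ≤ 6 + n → window y k ≡ 3) →
  y 0 + (y 1 + (y 3 + y 6)) ≡ 4 → ∀ j → j ≤ 6 + n → y j ≡ 1
row-equations⇒ones n y window≡3 last≡4 =
  let y0≡1 , y1≡1 , y2≡1 = initial-ones in periodic-constant y period y0≡1 y1≡1 y2≡1
  where
  open ≡-Reasoning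
  period : ∀ k → 3 + k ≤ 6 + n → y (3 + k) ≡ y k
  period = window-constant⇒periodic y window≡3
  y3≡y0 : y 3 ≡ y 0
  y3≡y0 = period 0 (m≤m+n 3 (3 + n))
  y6≡y0 : y 6 ≡ y 0
  y6≡y0 = trans (period 3 (m≤m+n 6 n)) y3≡y0
  3y0+y1≡4 : y 0 + (y 0 + (y 0 + y 1)) ≡ 4
  3y0+y1≡4 = begin
    y 0 + (y 0 + (y 0 + y 1)) ≡⟨ cong (y 0 +_) (trans (sym (+-assoc (y 0) _ _)) (+-comm _ (y 1))) ⟩
    y 0 + (y 1 + (y 0 + y 0)) ≡⟨ cong₂ (λ a b → y 0 + (y 1 + (a + b))) y3≡y0 y6≡y0 ⟨
    y 0 + (y 1 + (y 3 + y 6)) ≡⟨ last≡4 ⟩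
    4                         ∎
  initial-ones : y 0 ≡ 1 × y 1 ≡ 1 × y 2 ≡ 1
  initial-ones = reduced-system-solution (y 0) (y 1) (y 2) (window≡3 0 (m≤m+n 2 (4 + n))) 3y0+y1≡4

c-entry : ℕ → ℕ → ℕ
c-entry m i = if suc i ≡ᵇ m then 4 else 3

row-equation : ∀ {m} (x : Fin (suc m) → ℕ) → (∀ r → mulVec (A m) x r ≡ c m r) →
  ∀ i → i < m → rowSum m (suc i) (asSequence x) ≡ c-entry m i
row-equation {m} x solves i i<m =
  subst (λ i → rowSum m (suc i) (asSequence x) ≡ c-entry m i) (toℕ-fromℕ< i<m)
    (trans (sym (mulVec-A≡rowSum x r)) (solves r))
  where r = fromℕ< i<m

solution⇒ones : ∀ n (x : Fin (7 + n) → ℕ) → (∀ r → mulVec (A (6 + n)) x r ≡ c (6 + n) r) → ∀ s → x s ≡ 1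
solution⇒ones n x solves s = begin
  x s                  ≡⟨ cong x (mod-toℕ s) ⟨
  asSequence x (toℕ s) ≡⟨ row-equations⇒ones n y window≡3 last≡4 (toℕ s) (s≤s⁻¹ (toℕ<n s)) ⟩
  1                    ∎
  where
  open ≡-Reasoning
  y : ℕ → ℕ
  y = asSequence x
  window≡3 : ∀ k → 2 + k ≤ 6 + n → window y k ≡ 3
  window≡3 k 2+k≤m = begin
    window y k                ≡⟨ rowSum-window y 2+k≤m ⟨
    rowSum (6 + n) (suc k) y  ≡⟨ row-equation x solves k (≤-trans (n≤1+n _) 2+k≤m) ⟩
    c-entry (6 + n) k         ≡⟨ if-≡ᵇ-≢ (<⇒≢ 2+k≤m) ⟩
    3                         ∎
  last≡4 : y 0 + (y 1 + (y 3 + y 6)) ≡ 4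
  last≡4 = begin
    y 0 + (y 1 + (y 3 + y 6)) ≡⟨ rowSum-last n y ⟨
    rowSum (6 + n) (6 + n) y  ≡⟨ row-equation x solves (5 + n) ≤-refl ⟩
    c-entry (6 + n) (5 + n)   ≡⟨ if-≡ᵇ-≡ {m = 6 + n} refl ⟩
    4                         ∎

ones⇒row-equations : ∀ n (y : ℕ → ℕ) → (∀ j → y j ≡ 1) →
  ∀ i → i < 6 + n → rowSum (6 + n) (suc i) y ≡ c-entry (6 + n) i
ones⇒row-equations n y y≡1 i i<m with suc i ≟ 6 + n
... | yes is-last = begin
  rowSum (6 + n) (suc i) y  ≡⟨ cong (λ i → rowSum (6 + n) i y) is-last ⟩
  rowSum (6 + n) (6 + n) y  ≡⟨ rowSum-last n y ⟩
  y 0 + (y 1 + (y 3 + y 6)) ≡⟨ cong₂ _+_ (y≡1 0) (cong₂ _+_ (y≡1 1) (cong₂ _+_ (y≡1 3) (y≡1 6))) ⟩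
  4                         ≡⟨ if-≡ᵇ-≡ is-last ⟨
  c-entry (6 + n) i         ∎
  where open ≡-Reasoning
... | no not-last = begin
  rowSum (6 + n) (suc i) y  ≡⟨ rowSum-window y (≤∧≢⇒< i<m not-last) ⟩
  window y i                ≡⟨ cong₂ _+_ (y≡1 i) (cong₂ _+_ (y≡1 (1 + i)) (y≡1 (2 + i))) ⟩
  3                         ≡⟨ if-≡ᵇ-≢ not-last ⟨
  c-entry (6 + n) i         ∎
  where open ≡-Reasoning

ones⇒solution : ∀ n (x : Fin (7 + n) → ℕ) → (∀ s → x s ≡ 1) → ∀ r → mulVec (A (6 + n)) x r ≡ c (6 + n) r
ones⇒solution n x ones r =
  trans (mulVec-A≡rowSum x r) (ones⇒row-equations n (asSequence x) (λ j → ones _) (toℕ r) (toℕ<n r))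

lemma6 : (m : ℕ) → 6 ≤ m → (x : Fin (suc m) → ℕ) →
    ((∀ r → mulVec (A m) x r ≡ c m r) → ∀ s → x s ≡ 1) ×
    ((∀ s → x s ≡ 1) → ∀ r → mulVec (A m) x r ≡ c m r)
lemma6 m 6≤m x with m≤n⇒∃[o]m+o≡n 6≤m
... | n , refl = solution⇒ones n x , ones⇒solution n x
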